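{- Let $(A,B,\epsilon,\mu_A,l,r)$ be a Frobenius structure in a symmetric monoidal category and let $\mu_B:=\rhd\circ(B\otimes r^{ -1})=\lhd\circ(l^{ -1}\otimes B): B\otimes B\to B$. Then: (1) $(A,B,\epsilon,\mu_A\circ\sigma_{A,A},r,l)$ is a Frobenius structure; (2) $(B,\mu_B)$ is a semigroup; (3) $\lhd\circ(A\otimes l)=l\circ\mu_A$ and $\rhd\circ(r\otimes A)=r\circ\mu_A$ as maps $A\otimes A\to B$; (4) $l$ and $r$ are semigroup homomorphisms from $(A,\mu_A)$ to $(B,\mu_B)$; (5) $(B,A,\epsilon\circ\sigma_{B,A},\mu_B,r^{ -1},l^{ -1})$ is a Frobenius structure.
   Context: $\mathcal{V}$ is taken strict with symmetry $\sigma$; $0$ is a fixed object. A dual pairing is $\epsilon:A\otimes B\to 0$ such that for all $X$ the maps $\hom(X,B)\to\hom(A\otimes X,0)$, $f\mapsto\epsilon\circ(A\otimes f)$, and $\hom(X,A)\to\hom(X\otimes B,0)$, $g\mapsto\epsilon\circ(g\otimes B)$, are bijections. For a dual pairing and a multiplication $\mu_A$, $\lhd:A\otimes B\to B$ is the unique map with $\epsilon\circ(A\otimes\lhd)=\epsilon\circ(\mu_A\otimes B)$, and $\rhd:B\otimes A\to B$ the unique map with $\epsilon\circ(A\otimes\rhd)=\epsilon\circ(\mu_A\otimes B)\circ\sigma_{A\otimes B,A}$. A Frobenius structure is $(A,B,\epsilon,\mu_A,l,r)$ with $\epsilon$ a dual pairing, $\mu_A$ associative, $l,r:A\to B$ isomorphisms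 with $\epsilon\circ(A\otimes r)=\epsilon\circ(A\otimes l)\circ\sigma_{A,A}$ and $\lhd\circ(A\otimes r)=\rhd\circ(l\otimes A)$. (For the tuple in (5), the action maps are those defined from the pairing $\epsilon\circ\sigma_{B,A}:B\otimes A\to 0$ and $\mu_B$.) The equality of the two expressions defining $\mu_B$ holds for every Frobenius structure. -}

module Defs where

open import Level using (Level; _⊔_; suc)
open import Data.Product using (Σ; Σ-syntax; _×_; proj₁; proj₂)
open import Relation.Binary using (Rel; IsEquivalence)

record SymmetricMonoidalCategory (o ℓ e : Level) : Set (suc (o ⊔ ℓ ⊔ e)) where
  infixr 9 _∘_
  infixr 10 _⊗₀_ _⊗₁_
  infix  4 _≈_
  infixr 5 _⇒_
  field
    Obj : Set o
    _⇒_ : Obj → Obj → Set ℓ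
    _≈_ : ∀ {X Y} → Rel (X ⇒ Y) e
    ≈-equiv : ∀ {X Y} → IsEquivalence (_≈_ {X} {Y})
    id  : ∀ {X} → X ⇒ X
    _∘_ : ∀ {X Y Z} → Y ⇒ Z → X ⇒ Y → X ⇒ Z
    identityˡ : ∀ {X Y} {f : X ⇒ Y} → id ∘ f ≈ f
    identityʳ : ∀ {X Y} {f : X ⇒ Y} → f ∘ id ≈ f
    ∘-assoc   : ∀ {W X Y Z} {f : W ⇒ X} {g : X ⇒ Y} {h : Y ⇒ Z} →
                (h ∘ g) ∘ f ≈ h ∘ (g ∘ f)
    ∘-resp-≈  : ∀ {X Y Z} {f f′ : Y ⇒ Z} {g g′ : X ⇒ Y} →
                f ≈ f′ → g ≈ g′ → f ∘ g ≈ f′ ∘ g′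

    _⊗₀_ : Obj → Obj → Obj
    _⊗₁_ : ∀ {X Y X′ Y′} → X ⇒ X′ → Y ⇒ Y′ → (X ⊗₀ Y) ⇒ (X′ ⊗₀ Y′)
    ⊗-id    : ∀ {X Y} → id {X} ⊗₁ id {Y} ≈ id
    ⊗-∘     : ∀ {X Y Z X′ Y′ Z′} {f : Y ⇒ Z} {g : X ⇒ Y} {h : Y′ ⇒ Z′} {k : X′ ⇒ Y′} →
              (f ∘ g) ⊗₁ (h ∘ k) ≈ (f ⊗₁ h) ∘ (g ⊗₁ k)
    ⊗-resp-≈ : ∀ {X Y X′ Y′} {f f′ : X ⇒ X′} {g g′ : Y ⇒ Y′} →
               f ≈ f′ → g ≈ g′ → f ⊗₁ g ≈ f′ ⊗₁ g′

    I  : Obj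
    λ⇒ : ∀ {X} → (I ⊗₀ X) ⇒ X
    λ⇐ : ∀ {X} → X ⇒ (I ⊗₀ X)
    ρ⇒ : ∀ {X} → (X ⊗₀ I) ⇒ X
    ρ⇐ : ∀ {X} → X ⇒ (X ⊗₀ I)
    λ-isoˡ : ∀ {X} → λ⇐ ∘ λ⇒ {X} ≈ id
    λ-isoʳ : ∀ {X} → λ⇒ ∘ λ⇐ {X} ≈ id
    ρ-isoˡ : ∀ {X} → ρ⇐ ∘ ρ⇒ {X} ≈ id
    ρ-isoʳ : ∀ {X} → ρ⇒ ∘ ρ⇐ {X} ≈ id
    λ-natural : ∀ {X Y} {f : X ⇒ Y} → λ⇒ ∘ (id ⊗₁ f) ≈ f ∘ λ⇒
    ρ-natural : ∀ {X Y} {f : X ⇒ Y} → ρ⇒ ∘ (f ⊗₁ id) ≈ f ∘ ρ⇒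

    α⇒ : ∀ {X Y Z} → ((X ⊗₀ Y) ⊗₀ Z) ⇒ (X ⊗₀ (Y ⊗₀ Z))
    α⇐ : ∀ {X Y Z} → (X ⊗₀ (Y ⊗₀ Z)) ⇒ ((X ⊗₀ Y) ⊗₀ Z)
    α-isoˡ : ∀ {X Y Z} → α⇐ ∘ α⇒ {X} {Y} {Z} ≈ id
    α-isoʳ : ∀ {X Y Z} → α⇒ ∘ α⇐ {X} {Y} {Z} ≈ id
    α-natural : ∀ {X Y Z X′ Y′ Z′} {f : X ⇒ X′} {g : Y ⇒ Y′} {h : Z ⇒ Z′} →
                α⇒ ∘ ((f ⊗₁ g) ⊗₁ h) ≈ (f ⊗₁ (g ⊗₁ h)) ∘ α⇒

    σ : ∀ {X Y} → (X ⊗₀ Y) ⇒ (Y ⊗₀ X)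
    σ-natural : ∀ {X Y X′ Y′} {f : X ⇒ X′} {g : Y ⇒ Y′} →
                σ ∘ (f ⊗₁ g) ≈ (g ⊗₁ f) ∘ σ
    σ-involutive : ∀ {X Y} → σ {Y} {X} ∘ σ {X} {Y} ≈ id

    triangle : ∀ {X Y} → (id {X} ⊗₁ λ⇒ {Y}) ∘ α⇒ ≈ ρ⇒ ⊗₁ id
    pentagon : ∀ {W X Y Z} →
               (id {W} ⊗₁ α⇒ {X} {Y} {Z}) ∘ α⇒ ∘ (α⇒ ⊗₁ id) ≈ α⇒ ∘ α⇒
    hexagon  : ∀ {X Y Z} →
               α⇒ {Y} {Z} {X} ∘ σ ∘ α⇒ {X} {Y} {Z} ≈
               (id ⊗₁ σ) ∘ α⇒ ∘ (σ ⊗₁ id)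

-- Frobenius structures in a symmetric monoidal category, relative to a
-- fixed object 0 (called `O` here).

module Frobenius {o ℓ e} (𝒱 : SymmetricMonoidalCategory o ℓ e) where
  open SymmetricMonoidalCategory 𝒱 public

  _◃_ : ∀ (A : Obj) {X Y} → X ⇒ Y → (A ⊗₀ X) ⇒ (A ⊗₀ Y)
  A ◃ f = id {A} ⊗₁ f

  _▹_ : ∀ {X Y} → X ⇒ Y → (B : Obj) → (X ⊗₀ B) ⇒ (Y ⊗₀ B)
  g ▹ B = g ⊗₁ id {B}

  IsIso : ∀ {X Y} → X ⇒ Y → Set (ℓ ⊔ e)
  IsIso {X} {Y} f = Σ[ g ∈ Y ⇒ X ] ((g ∘ f ≈ id) × (f ∘ g ≈ id))

  record IsBijection {a b : Level} {S : Set a} {T : Set b}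
                     (_≈S_ : Rel S e) (_≈T_ : Rel T e) (F : S → T)
                     : Set (a ⊔ b ⊔ e) where
    field
      injective  : ∀ {s s′} → F s ≈T F s′ → s ≈S s′
      surjective : ∀ (t : T) → Σ[ s ∈ S ] (F s ≈T t)

  record IsDualPairing (O A B : Obj) (ε : (A ⊗₀ B) ⇒ O) : Set (o ⊔ ℓ ⊔ e) where
    field
      right : ∀ (X : Obj) →
              IsBijection (_≈_ {X} {B}) (_≈_ {A ⊗₀ X} {O}) (λ f → ε ∘ (A ◃ f))
      left  : ∀ (X : Obj) →
              IsBijection (_≈_ {X} {A}) (_≈_ {X ⊗₀ B} {O}) (λ g → ε ∘ (g ▹ B))

    transposeʳ : ∀ {X} → (A ⊗₀ X) ⇒ O → X ⇒ B
    transposeʳ {X} h = proj₁ (IsBijection.surjective (right X) h)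

  module Actions {O A B : Obj} {ε : (A ⊗₀ B) ⇒ O} (dp : IsDualPairing O A B ε)
                 (μ : (A ⊗₀ A) ⇒ A) where
    open IsDualPairing dp
    -- ◁ : A ⊗ B → B,  ε ∘ (A ⊗ ◁) = ε ∘ (μ ⊗ B)   (reassociated)
    ◁ : (A ⊗₀ B) ⇒ B
    ◁ = transposeʳ (ε ∘ (μ ▹ B) ∘ α⇐)
    -- ▷ : B ⊗ A → B,  ε ∘ (A ⊗ ▷) = ε ∘ (μ ⊗ B) ∘ σ_{A⊗B,A}   (reassociated)
    ▷ : (B ⊗₀ A) ⇒ B
    ▷ = transposeʳ (ε ∘ (μ ▹ B) ∘ α⇐ ∘ σ {A ⊗₀ B} {A} ∘ α⇐)

  Associative : ∀ {A} → (A ⊗₀ A) ⇒ A → Set e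
  Associative {A} μ = μ ∘ (μ ▹ A) ≈ μ ∘ (A ◃ μ) ∘ α⇒

  record IsFrobenius (O A B : Obj) (ε : (A ⊗₀ B) ⇒ O) (μ : (A ⊗₀ A) ⇒ A)
                     (l r : A ⇒ B) : Set (o ⊔ ℓ ⊔ e) where
    field
      pairing : IsDualPairing O A B ε
      assoc   : Associative μ
      l-iso   : IsIso l
      r-iso   : IsIso r
      ε-lr    : ε ∘ (A ◃ r) ≈ (ε ∘ (A ◃ l)) ∘ σ {A} {A}
    open Actions pairing μ public
    field
      ◁▷-lr   : ◁ ∘ (A ◃ r) ≈ ▷ ∘ (l ▹ A)

    l⁻¹ : B ⇒ A
    l⁻¹ = proj₁ l-iso
    r⁻¹ : B ⇒ A
    r⁻¹ = proj₁ r-iso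

    μB : (B ⊗₀ B) ⇒ B
    μB = ▷ ∘ (B ◃ r⁻¹)

{-# OPTIONS --safe #-}
module Submission where

-- Every identity is verified after pairing with ε, which is injective in either
-- argument.  Pairing the axiom ◁ ∘ (A ⊗ r) = ▷ ∘ (l ⊗ A) with A gives the cyclic
-- symmetry ε(a a′, r a″) = ε(a″ a, l a′) of the trilinear form ε ∘ (μ ⊗ –)
-- (ε-μ-cyclic); combined with ε(a, r a′) = ε(a′, l a) it yields (3).  Part (3)
-- says that l and r intertwine μ with μ_B, so (4) follows, and μ_B inherits
-- associativity from μ along the isomorphism l.  For (1) and (5) one identifies
-- the actions of the new structures: for μ ∘ σ they are ▷ ∘ σ and ◁ ∘ σ, and for
-- μ_B with the swapped pairing ε ∘ σ they are μ ∘ (r⁻¹ ⊗ A) and μ ∘ (A ⊗ l⁻¹).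
-- The remaining bookkeeping is symmetric monoidal coherence, mainly σ-rotate².

open import Defs
open import Data.Product using (_×_; _,_; proj₁; proj₂)
open import Relation.Binary using (Setoid; IsEquivalence)
import Relation.Binary.Reasoning.Setoid as SetoidReasoning

module _ {o ℓ e} (𝒱 : SymmetricMonoidalCategory o ℓ e) where
  open Frobenius 𝒱

  private
    module ≈ {X Y} = IsEquivalence (≈-equiv {X} {Y})

    hom-setoid : Obj → Obj → Setoid ℓ e
    hom-setoid X Y = record { Carrier = X ⇒ Y ; _≈_ = _≈_ ; isEquivalence = ≈-equiv }

    module HomReasoning {X Y : Obj} = SetoidReasoning (hom-setoid X Y)
    open HomReasoning

  infixr 4 _⟩∘⟨_ refl⟩∘⟨_
  infixl 5 _⟩∘⟨refl

  _⟩∘⟨_ : ∀ {X Y Z} {f f′ : Y ⇒ Z} {g g′ : X ⇒ Y} → f ≈ f′ → g ≈ g′ → f ∘ g ≈ f′ ∘ g′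
  _⟩∘⟨_ = ∘-resp-≈

  refl⟩∘⟨_ : ∀ {X Y Z} {f : Y ⇒ Z} {g g′ : X ⇒ Y} → g ≈ g′ → f ∘ g ≈ f ∘ g′
  refl⟩∘⟨_ = ≈.refl ⟩∘⟨_

  _⟩∘⟨refl : ∀ {X Y Z} {f f′ : Y ⇒ Z} {g : X ⇒ Y} → f ≈ f′ → f ∘ g ≈ f′ ∘ g
  p ⟩∘⟨refl = p ⟩∘⟨ ≈.refl

  sym-assoc : ∀ {W X Y Z} {f : W ⇒ X} {g : X ⇒ Y} {h : Y ⇒ Z} → h ∘ (g ∘ f) ≈ (h ∘ g) ∘ f
  sym-assoc = ≈.sym ∘-assoc

  pullˡ : ∀ {W X Y Z} {f : Y ⇒ Z} {g : X ⇒ Y} {h : X ⇒ Z} {k : W ⇒ X} →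
          f ∘ g ≈ h → f ∘ (g ∘ k) ≈ h ∘ k
  pullˡ p = ≈.trans sym-assoc (p ⟩∘⟨refl)

  extendʳ : ∀ {W X X′ Y Z} {f : Y ⇒ Z} {g : X ⇒ Y} {h : X′ ⇒ Z} {i : X ⇒ X′} {k : W ⇒ X} →
            f ∘ g ≈ h ∘ i → f ∘ (g ∘ k) ≈ h ∘ (i ∘ k)
  extendʳ p = ≈.trans (pullˡ p) ∘-assoc

  extendˡ : ∀ {W X X′ Y Z} {f : Y ⇒ Z} {g : X ⇒ Y} {h : X′ ⇒ Z} {i : X ⇒ X′} {k : Z ⇒ W} →
            f ∘ g ≈ h ∘ i → (k ∘ f) ∘ g ≈ (k ∘ h) ∘ i
  extendˡ p = ≈.trans ∘-assoc (≈.trans (refl⟩∘⟨ p) sym-assoc)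

  assoc₃ : ∀ {V W X Y Z} {a : Y ⇒ Z} {b : X ⇒ Y} {c : W ⇒ X} {k : V ⇒ W} →
           (a ∘ b ∘ c) ∘ k ≈ a ∘ b ∘ c ∘ k
  assoc₃ = ≈.trans ∘-assoc (refl⟩∘⟨ ∘-assoc)

  assoc₅ : ∀ {T U V W X Y Z} {a : Y ⇒ Z} {b : X ⇒ Y} {c : W ⇒ X} {d : V ⇒ W} {f : U ⇒ V}
           {k : T ⇒ U} → (a ∘ b ∘ c ∘ d ∘ f) ∘ k ≈ a ∘ b ∘ c ∘ d ∘ f ∘ k
  assoc₅ = ≈.trans ∘-assoc (refl⟩∘⟨ ≈.trans ∘-assoc (refl⟩∘⟨ assoc₃))

  pull₃ : ∀ {V W X Y Z} {a : Y ⇒ Z} {b : X ⇒ Y} {c : W ⇒ X} {d : W ⇒ Z} {k : V ⇒ W} →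
          a ∘ b ∘ c ≈ d → a ∘ b ∘ c ∘ k ≈ d ∘ k
  pull₃ p = ≈.trans (≈.sym assoc₃) (p ⟩∘⟨refl)

  cancelˡ : ∀ {X Y Z} {h : Y ⇒ X} {i : X ⇒ Y} {f : Z ⇒ X} → h ∘ i ≈ id → h ∘ (i ∘ f) ≈ f
  cancelˡ p = ≈.trans (pullˡ p) identityˡ

  cancelʳ : ∀ {X Y Z} {h : Y ⇒ X} {i : X ⇒ Y} {f : X ⇒ Z} → h ∘ i ≈ id → (f ∘ h) ∘ i ≈ f
  cancelʳ p = ≈.trans ∘-assoc (≈.trans (refl⟩∘⟨ p) identityʳ)

  id-comm : ∀ {X Y} {f : X ⇒ Y} → f ∘ id ≈ id ∘ f
  id-comm = ≈.trans identityʳ (≈.sym identityˡ)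

  split-epi-cancel : ∀ {X Y Z} {f g : Y ⇒ Z} {i : X ⇒ Y} {j : Y ⇒ X} →
                     i ∘ j ≈ id → f ∘ i ≈ g ∘ i → f ≈ g
  split-epi-cancel {f = f} {g} {i} {j} ij p = begin
    f            ≈⟨ cancelʳ ij ⟨
    (f ∘ i) ∘ j  ≈⟨ p ⟩∘⟨refl ⟩
    (g ∘ i) ∘ j  ≈⟨ cancelʳ ij ⟩
    g            ∎

  inverse-unique : ∀ {X Y} {f g : X ⇒ Y} {f′ g′ : Y ⇒ X} →
                   f ≈ g → f′ ∘ f ≈ id → g ∘ g′ ≈ id → f′ ≈ g′
  inverse-unique {f = f} {g} {f′} {g′} f≈g f′f gg′ = begin
    f′              ≈⟨ identityʳ ⟨
    f′ ∘ id         ≈⟨ refl⟩∘⟨ gg′ ⟨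
    f′ ∘ (g ∘ g′)   ≈⟨ refl⟩∘⟨ f≈g ⟩∘⟨refl ⟨
    f′ ∘ (f ∘ g′)   ≈⟨ cancelˡ f′f ⟩
    g′              ∎

  inverse-∘₃ : ∀ {W X Y Z} {a : Y ⇒ Z} {b : X ⇒ Y} {c : W ⇒ X}
               {a′ : Z ⇒ Y} {b′ : Y ⇒ X} {c′ : X ⇒ W} →
               a′ ∘ a ≈ id → b′ ∘ b ≈ id → c′ ∘ c ≈ id →
               (c′ ∘ b′ ∘ a′) ∘ (a ∘ b ∘ c) ≈ id
  inverse-∘₃ {a = a} {b} {c} {a′} {b′} {c′} a′a b′b c′c = begin
    (c′ ∘ b′ ∘ a′) ∘ (a ∘ b ∘ c)  ≈⟨ assoc₃ ⟩
    c′ ∘ b′ ∘ a′ ∘ a ∘ b ∘ c      ≈⟨ refl⟩∘⟨ refl⟩∘⟨ cancelˡ a′a ⟩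
    c′ ∘ b′ ∘ b ∘ c              ≈⟨ refl⟩∘⟨ cancelˡ b′b ⟩
    c′ ∘ c                       ≈⟨ c′c ⟩
    id                           ∎

  ⊗-inverse : ∀ {X Y X′ Y′} {f : X ⇒ X′} {f′ : X′ ⇒ X} {g : Y ⇒ Y′} {g′ : Y′ ⇒ Y} →
              f ∘ f′ ≈ id → g ∘ g′ ≈ id → (f ⊗₁ g) ∘ (f′ ⊗₁ g′) ≈ id
  ⊗-inverse ff′ gg′ = ≈.trans (≈.sym ⊗-∘) (≈.trans (⊗-resp-≈ ff′ gg′) ⊗-id)

  ◃-inverse : ∀ {A X Y} {f : X ⇒ Y} {f′ : Y ⇒ X} → f ∘ f′ ≈ id → (A ◃ f) ∘ (A ◃ f′) ≈ id
  ◃-inverse = ⊗-inverse identityˡ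

  ▹-inverse : ∀ {A X Y} {f : X ⇒ Y} {f′ : Y ⇒ X} → f ∘ f′ ≈ id → (f ▹ A) ∘ (f′ ▹ A) ≈ id
  ▹-inverse ff′ = ⊗-inverse ff′ identityˡ

  ◃-∘ : ∀ {A X Y Z} {f : Y ⇒ Z} {g : X ⇒ Y} → (A ◃ f) ∘ (A ◃ g) ≈ A ◃ (f ∘ g)
  ◃-∘ = ≈.trans (≈.sym ⊗-∘) (⊗-resp-≈ identityˡ ≈.refl)

  ▹-∘ : ∀ {A X Y Z} {f : Y ⇒ Z} {g : X ⇒ Y} → (f ▹ A) ∘ (g ▹ A) ≈ (f ∘ g) ▹ A
  ▹-∘ = ≈.trans (≈.sym ⊗-∘) (⊗-resp-≈ ≈.refl identityˡ)

  ⊗-as-▹◃ : ∀ {X Y X′ Y′} {f : X ⇒ X′} {g : Y ⇒ Y′} → f ⊗₁ g ≈ (f ▹ Y′) ∘ (X ◃ g)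
  ⊗-as-▹◃ = ≈.trans (⊗-resp-≈ (≈.sym identityʳ) (≈.sym identityˡ)) ⊗-∘

  ⊗-as-◃▹ : ∀ {X Y X′ Y′} {f : X ⇒ X′} {g : Y ⇒ Y′} → f ⊗₁ g ≈ (X′ ◃ g) ∘ (f ▹ Y)
  ⊗-as-◃▹ = ≈.trans (⊗-resp-≈ (≈.sym identityˡ) (≈.sym identityʳ)) ⊗-∘

  ▹◃-comm : ∀ {X Y X′ Y′} {f : X ⇒ X′} {g : Y ⇒ Y′} → (f ▹ Y′) ∘ (X ◃ g) ≈ (X′ ◃ g) ∘ (f ▹ Y)
  ▹◃-comm = ≈.trans (≈.sym ⊗-as-▹◃) ⊗-as-◃▹

  ⊗-∘σ : ∀ {X Y X′ Y′} {f : X ⇒ X′} {g : Y ⇒ Y′} →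
         (f ⊗₁ g) ∘ σ {Y} {X} ≈ (X′ ◃ g) ∘ σ ∘ (Y ◃ f)
  ⊗-∘σ = ≈.trans (⊗-as-◃▹ ⟩∘⟨refl) (≈.trans ∘-assoc (refl⟩∘⟨ ≈.sym σ-natural))

  α⇐-natural : ∀ {X Y Z X′ Y′ Z′} {f : X ⇒ X′} {g : Y ⇒ Y′} {h : Z ⇒ Z′} →
               α⇐ ∘ (f ⊗₁ (g ⊗₁ h)) ≈ ((f ⊗₁ g) ⊗₁ h) ∘ α⇐
  α⇐-natural {f = f} {g} {h} = begin
    α⇐ ∘ (f ⊗₁ (g ⊗₁ h))                ≈⟨ refl⟩∘⟨ cancelʳ α-isoʳ ⟨
    α⇐ ∘ ((f ⊗₁ (g ⊗₁ h)) ∘ α⇒) ∘ α⇐    ≈⟨ refl⟩∘⟨ α-natural ⟩∘⟨refl ⟨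
    α⇐ ∘ (α⇒ ∘ ((f ⊗₁ g) ⊗₁ h)) ∘ α⇐    ≈⟨ refl⟩∘⟨ ∘-assoc ⟩
    α⇐ ∘ α⇒ ∘ ((f ⊗₁ g) ⊗₁ h) ∘ α⇐      ≈⟨ cancelˡ α-isoˡ ⟩
    ((f ⊗₁ g) ⊗₁ h) ∘ α⇐                ∎

  α⇐-◃◃ : ∀ {X Y Z Z′} {h : Z ⇒ Z′} → α⇐ ∘ (X ◃ (Y ◃ h)) ≈ ((X ⊗₀ Y) ◃ h) ∘ α⇐
  α⇐-◃◃ = ≈.trans α⇐-natural (⊗-resp-≈ ⊗-id ≈.refl ⟩∘⟨refl)

  α⇐-▹ : ∀ {X X′ Y Z} {f : X ⇒ X′} → α⇐ ∘ (f ▹ (Y ⊗₀ Z)) ≈ ((f ▹ Y) ▹ Z) ∘ α⇐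
  α⇐-▹ = ≈.trans (refl⟩∘⟨ ⊗-resp-≈ ≈.refl (≈.sym ⊗-id)) α⇐-natural

  hexagon⁻¹ : ∀ {X Y Z} →
              α⇐ {Y} {X} {Z} ∘ σ {X ⊗₀ Z} {Y} ∘ α⇐ {X} {Z} {Y} ≈
              (σ {X} {Y} ▹ Z) ∘ α⇐ {X} {Y} {Z} ∘ (X ◃ σ {Z} {Y})
  hexagon⁻¹ {X} {Y} {Z} = inverse-unique (hexagon {Y} {X} {Z})
    (inverse-∘₃ α-isoˡ σ-involutive α-isoˡ)
    (inverse-∘₃ (▹-inverse σ-involutive) α-isoʳ (◃-inverse σ-involutive))

  reverse₃ : ∀ {X Y Z} →
             (Z ◃ σ {X} {Y}) ∘ σ {X ⊗₀ Y} {Z} ≈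
             α⇒ {Z} {Y} {X} ∘ (σ {Y} {Z} ▹ X) ∘ σ {X} {Y ⊗₀ Z} ∘ α⇒ {X} {Y} {Z}
  reverse₃ {X} {Y} {Z} = begin
    (Z ◃ σ) ∘ σ                                        ≈⟨ σ-natural ⟨
    σ {Y ⊗₀ X} ∘ (σ ▹ Z)                               ≈⟨ cancelˡ α-isoʳ ⟨
    α⇒ ∘ α⇐ ∘ σ ∘ (σ ▹ Z)                              ≈⟨ refl⟩∘⟨ refl⟩∘⟨ refl⟩∘⟨ cancelˡ α-isoˡ ⟨
    α⇒ ∘ α⇐ ∘ σ ∘ α⇐ ∘ α⇒ ∘ (σ ▹ Z)                    ≈⟨ refl⟩∘⟨ pull₃ hexagon⁻¹ ⟩
    α⇒ ∘ ((σ ▹ X) ∘ α⇐ ∘ (Y ◃ σ)) ∘ α⇒ ∘ (σ ▹ Z)       ≈⟨ refl⟩∘⟨ assoc₃ ⟩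
    α⇒ ∘ (σ ▹ X) ∘ α⇐ ∘ (Y ◃ σ) ∘ α⇒ ∘ (σ ▹ Z)         ≈⟨ refl⟩∘⟨ refl⟩∘⟨ refl⟩∘⟨ hexagon ⟨
    α⇒ ∘ (σ ▹ X) ∘ α⇐ ∘ α⇒ ∘ σ ∘ α⇒                    ≈⟨ refl⟩∘⟨ refl⟩∘⟨ cancelˡ α-isoˡ ⟩
    α⇒ ∘ (σ ▹ X) ∘ σ ∘ α⇒                              ∎

  σ-rotate² : ∀ {X Y Z} →
              α⇐ {Y} {Z} {X} ∘ σ {Z ⊗₀ X} {Y} ∘ α⇐ {Z} {X} {Y} ∘ σ {X ⊗₀ Y} {Z} ∘ α⇐ {X} {Y} {Z}
              ≈ σ {X} {Y ⊗₀ Z}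
  σ-rotate² {X} {Y} {Z} = begin
    α⇐ ∘ σ ∘ α⇐ ∘ σ ∘ α⇐                               ≈⟨ pull₃ hexagon⁻¹ ⟩
    ((σ ▹ X) ∘ α⇐ ∘ (Z ◃ σ)) ∘ σ ∘ α⇐                 ≈⟨ assoc₃ ⟩
    (σ ▹ X) ∘ α⇐ ∘ (Z ◃ σ) ∘ σ ∘ α⇐                   ≈⟨ refl⟩∘⟨ refl⟩∘⟨ pullˡ reverse₃ ⟩
    (σ ▹ X) ∘ α⇐ ∘ (α⇒ ∘ (σ ▹ X) ∘ σ ∘ α⇒) ∘ α⇐       ≈⟨ refl⟩∘⟨ refl⟩∘⟨ ∘-assoc ⟩
    (σ ▹ X) ∘ α⇐ ∘ α⇒ ∘ ((σ ▹ X) ∘ σ ∘ α⇒) ∘ α⇐       ≈⟨ refl⟩∘⟨ cancelˡ α-isoˡ ⟩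
    (σ ▹ X) ∘ ((σ ▹ X) ∘ σ ∘ α⇒) ∘ α⇐                 ≈⟨ refl⟩∘⟨ assoc₃ ⟩
    (σ ▹ X) ∘ (σ ▹ X) ∘ σ ∘ α⇒ ∘ α⇐                   ≈⟨ cancelˡ (▹-inverse σ-involutive) ⟩
    σ ∘ α⇒ ∘ α⇐                                        ≈⟨ refl⟩∘⟨ α-isoʳ ⟩
    σ ∘ id                                             ≈⟨ identityʳ ⟩
    σ                                                  ∎

  Associative-op : ∀ {A} {μ : (A ⊗₀ A) ⇒ A} → Associative μ → Associative (μ ∘ σ {A} {A})
  Associative-op {A} {μ} assoc = begin
    (μ ∘ σ) ∘ ((μ ∘ σ) ▹ A)              ≈⟨ ∘-assoc ⟩
    μ ∘ σ ∘ ((μ ∘ σ) ▹ A)                ≈⟨ refl⟩∘⟨ σ-natural ⟩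
    μ ∘ (A ◃ (μ ∘ σ)) ∘ σ                ≈⟨ refl⟩∘⟨ ◃-∘ ⟩∘⟨refl ⟨
    μ ∘ ((A ◃ μ) ∘ (A ◃ σ)) ∘ σ          ≈⟨ refl⟩∘⟨ ∘-assoc ⟩
    μ ∘ (A ◃ μ) ∘ (A ◃ σ) ∘ σ            ≈⟨ refl⟩∘⟨ refl⟩∘⟨ reverse₃ ⟩
    μ ∘ (A ◃ μ) ∘ α⇒ ∘ (σ ▹ A) ∘ σ ∘ α⇒  ≈⟨ pull₃ (≈.sym assoc) ⟩
    (μ ∘ (μ ▹ A)) ∘ (σ ▹ A) ∘ σ ∘ α⇒     ≈⟨ ∘-assoc ⟩
    μ ∘ (μ ▹ A) ∘ (σ ▹ A) ∘ σ ∘ α⇒       ≈⟨ refl⟩∘⟨ pullˡ ▹-∘ ⟩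
    μ ∘ ((μ ∘ σ) ▹ A) ∘ σ ∘ α⇒           ≈⟨ refl⟩∘⟨ extendʳ σ-natural ⟨
    μ ∘ σ ∘ (A ◃ (μ ∘ σ)) ∘ α⇒           ≈⟨ sym-assoc ⟩
    (μ ∘ σ) ∘ (A ◃ (μ ∘ σ)) ∘ α⇒         ∎

  Associative-transport : ∀ {A B} {μ : (A ⊗₀ A) ⇒ A} {ν : (B ⊗₀ B) ⇒ B} {h : A ⇒ B} →
                          IsIso h → h ∘ μ ≈ ν ∘ (h ⊗₁ h) → Associative μ → Associative ν
  Associative-transport {A} {B} {μ} {ν} {h} (h⁻¹ , _ , hh⁻¹) hom assoc =
    split-epi-cancel (⊗-inverse (⊗-inverse hh⁻¹ hh⁻¹) hh⁻¹) (begin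
      (ν ∘ (ν ▹ B)) ∘ ((h ⊗₁ h) ⊗₁ h)          ≈⟨ ∘-assoc ⟩
      ν ∘ (ν ▹ B) ∘ ((h ⊗₁ h) ⊗₁ h)            ≈⟨ refl⟩∘⟨ ⊗-∘ ⟨
      ν ∘ ((ν ∘ (h ⊗₁ h)) ⊗₁ (id ∘ h))         ≈⟨ refl⟩∘⟨ ⊗-resp-≈ hom id-comm ⟨
      ν ∘ ((h ∘ μ) ⊗₁ (h ∘ id))                ≈⟨ refl⟩∘⟨ ⊗-∘ ⟩
      ν ∘ (h ⊗₁ h) ∘ (μ ▹ A)                   ≈⟨ pullˡ (≈.sym hom) ⟩
      (h ∘ μ) ∘ (μ ▹ A)                        ≈⟨ ∘-assoc ⟩
      h ∘ μ ∘ (μ ▹ A)                          ≈⟨ refl⟩∘⟨ assoc ⟩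
      h ∘ μ ∘ (A ◃ μ) ∘ α⇒                     ≈⟨ pullˡ hom ⟩
      (ν ∘ (h ⊗₁ h)) ∘ (A ◃ μ) ∘ α⇒            ≈⟨ ∘-assoc ⟩
      ν ∘ (h ⊗₁ h) ∘ (A ◃ μ) ∘ α⇒              ≈⟨ refl⟩∘⟨ pullˡ (≈.sym ⊗-∘) ⟩
      ν ∘ ((h ∘ id) ⊗₁ (h ∘ μ)) ∘ α⇒           ≈⟨ refl⟩∘⟨ ⊗-resp-≈ id-comm hom ⟩∘⟨refl ⟩
      ν ∘ ((id ∘ h) ⊗₁ (ν ∘ (h ⊗₁ h))) ∘ α⇒    ≈⟨ refl⟩∘⟨ ⊗-∘ ⟩∘⟨refl ⟩
      ν ∘ ((B ◃ ν) ∘ (h ⊗₁ (h ⊗₁ h))) ∘ α⇒     ≈⟨ refl⟩∘⟨ ∘-assoc ⟩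
      ν ∘ (B ◃ ν) ∘ (h ⊗₁ (h ⊗₁ h)) ∘ α⇒       ≈⟨ refl⟩∘⟨ refl⟩∘⟨ α-natural ⟨
      ν ∘ (B ◃ ν) ∘ α⇒ ∘ ((h ⊗₁ h) ⊗₁ h)       ≈⟨ assoc₃ ⟨
      (ν ∘ (B ◃ ν) ∘ α⇒) ∘ ((h ⊗₁ h) ⊗₁ h)     ∎)

  module DualPairingProperties {O A B : Obj} {ε : (A ⊗₀ B) ⇒ O} (dp : IsDualPairing O A B ε) where
    open IsDualPairing dp

    ◃-injective : ∀ {X} {f g : X ⇒ B} → ε ∘ (A ◃ f) ≈ ε ∘ (A ◃ g) → f ≈ g
    ◃-injective {X} = IsBijection.injective (right X)

    ▹-injective : ∀ {X} {f g : X ⇒ A} → ε ∘ (f ▹ B) ≈ ε ∘ (g ▹ B) → f ≈ g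
    ▹-injective {X} = IsBijection.injective (left X)

    transposeʳ-spec : ∀ {X} (h : (A ⊗₀ X) ⇒ O) → ε ∘ (A ◃ transposeʳ h) ≈ h
    transposeʳ-spec {X} h = proj₂ (IsBijection.surjective (right X) h)

    transposeʳ-unique : ∀ {X} {h : (A ⊗₀ X) ⇒ O} {g : X ⇒ B} → ε ∘ (A ◃ g) ≈ h → transposeʳ h ≈ g
    transposeʳ-unique {h = h} p = ◃-injective (≈.trans (transposeʳ-spec h) (≈.sym p))

    swapped : IsDualPairing O B A (ε ∘ σ)
    swapped = record { right = swapped-right ; left = swapped-left }
      where
      swapped-right : ∀ X → IsBijection _≈_ _≈_ (λ (f : X ⇒ A) → (ε ∘ σ) ∘ (B ◃ f))
      swapped-right X = record
        { injective  = λ p → ▹-injective (split-epi-cancel σ-involutive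
            (≈.trans (≈.sym (extendˡ σ-natural)) (≈.trans p (extendˡ σ-natural))))
        ; surjective = λ t →
            let (f , εf≈tσ) = IsBijection.surjective (left X) (t ∘ σ) in
            f , ≈.trans (extendˡ σ-natural) (≈.trans (εf≈tσ ⟩∘⟨refl) (cancelʳ σ-involutive))
        }
      swapped-left : ∀ X → IsBijection _≈_ _≈_ (λ (g : X ⇒ B) → (ε ∘ σ) ∘ (g ▹ A))
      swapped-left X = record
        { injective  = λ p → ◃-injective (split-epi-cancel σ-involutive
            (≈.trans (≈.sym (extendˡ σ-natural)) (≈.trans p (extendˡ σ-natural))))
        ; surjective = λ t →
            let (g , εg≈tσ) = IsBijection.surjective (right X) (t ∘ σ) in
            g , ≈.trans (extendˡ σ-natural) (≈.trans (εg≈tσ ⟩∘⟨refl) (cancelʳ σ-involutive))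
        }

    module _ (μ : (A ⊗₀ A) ⇒ A) where
      open Actions dp μ

      ◁-spec : ε ∘ (A ◃ ◁) ≈ ε ∘ (μ ▹ B) ∘ α⇐
      ◁-spec = transposeʳ-spec _

      ▷-spec : ε ∘ (A ◃ ▷) ≈ ε ∘ (μ ▹ B) ∘ α⇐ ∘ σ ∘ α⇐
      ▷-spec = transposeʳ-spec _

      ◁-◃ : ∀ {Y} (g : Y ⇒ B) → ε ∘ (A ◃ (◁ ∘ (A ◃ g))) ≈ (ε ∘ (μ ⊗₁ g)) ∘ α⇐
      ◁-◃ g = begin
        ε ∘ (A ◃ (◁ ∘ (A ◃ g)))             ≈⟨ refl⟩∘⟨ ◃-∘ ⟨
        ε ∘ (A ◃ ◁) ∘ (A ◃ (A ◃ g))         ≈⟨ pullˡ ◁-spec ⟩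
        (ε ∘ (μ ▹ B) ∘ α⇐) ∘ (A ◃ (A ◃ g))  ≈⟨ assoc₃ ⟩
        ε ∘ (μ ▹ B) ∘ α⇐ ∘ (A ◃ (A ◃ g))    ≈⟨ refl⟩∘⟨ refl⟩∘⟨ α⇐-◃◃ ⟩
        ε ∘ (μ ▹ B) ∘ ((A ⊗₀ A) ◃ g) ∘ α⇐   ≈⟨ refl⟩∘⟨ pullˡ (≈.sym ⊗-as-▹◃) ⟩
        ε ∘ (μ ⊗₁ g) ∘ α⇐                   ≈⟨ sym-assoc ⟩
        (ε ∘ (μ ⊗₁ g)) ∘ α⇐                 ∎

      ▷-▹ : ∀ {Y} (g : Y ⇒ B) → ε ∘ (A ◃ (▷ ∘ (g ▹ A))) ≈ (ε ∘ (μ ⊗₁ g)) ∘ α⇐ ∘ σ ∘ α⇐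
      ▷-▹ g = begin
        ε ∘ (A ◃ (▷ ∘ (g ▹ A)))                         ≈⟨ refl⟩∘⟨ ◃-∘ ⟨
        ε ∘ (A ◃ ▷) ∘ (A ◃ (g ▹ A))                     ≈⟨ pullˡ ▷-spec ⟩
        (ε ∘ (μ ▹ B) ∘ α⇐ ∘ σ ∘ α⇐) ∘ (A ◃ (g ▹ A))     ≈⟨ assoc₅ ⟩
        ε ∘ (μ ▹ B) ∘ α⇐ ∘ σ ∘ α⇐ ∘ (A ◃ (g ▹ A))       ≈⟨ refl⟩∘⟨ refl⟩∘⟨ refl⟩∘⟨ refl⟩∘⟨ α⇐-natural ⟩
        ε ∘ (μ ▹ B) ∘ α⇐ ∘ σ ∘ ((A ◃ g) ▹ A) ∘ α⇐       ≈⟨ refl⟩∘⟨ refl⟩∘⟨ refl⟩∘⟨ extendʳ σ-natural ⟩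
        ε ∘ (μ ▹ B) ∘ α⇐ ∘ (A ◃ (A ◃ g)) ∘ σ ∘ α⇐       ≈⟨ refl⟩∘⟨ refl⟩∘⟨ extendʳ α⇐-◃◃ ⟩
        ε ∘ (μ ▹ B) ∘ ((A ⊗₀ A) ◃ g) ∘ α⇐ ∘ σ ∘ α⇐      ≈⟨ refl⟩∘⟨ pullˡ (≈.sym ⊗-as-▹◃) ⟩
        ε ∘ (μ ⊗₁ g) ∘ α⇐ ∘ σ ∘ α⇐                      ≈⟨ sym-assoc ⟩
        (ε ∘ (μ ⊗₁ g)) ∘ α⇐ ∘ σ ∘ α⇐                    ∎

      private module Op = Actions dp (μ ∘ σ {A} {A})

      ◁-op : Op.◁ ≈ ▷ ∘ σ {A} {B}
      ◁-op = transposeʳ-unique (begin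
        ε ∘ (A ◃ (▷ ∘ σ))                                  ≈⟨ refl⟩∘⟨ ◃-∘ ⟨
        ε ∘ (A ◃ ▷) ∘ (A ◃ σ)                              ≈⟨ pullˡ ▷-spec ⟩
        (ε ∘ (μ ▹ B) ∘ α⇐ ∘ σ ∘ α⇐) ∘ (A ◃ σ)              ≈⟨ assoc₅ ⟩
        ε ∘ (μ ▹ B) ∘ α⇐ ∘ σ ∘ α⇐ ∘ (A ◃ σ)                ≈⟨ refl⟩∘⟨ refl⟩∘⟨ pull₃ hexagon⁻¹ ⟩
        ε ∘ (μ ▹ B) ∘ ((σ ▹ B) ∘ α⇐ ∘ (A ◃ σ)) ∘ (A ◃ σ)   ≈⟨ refl⟩∘⟨ refl⟩∘⟨ assoc₃ ⟩
        ε ∘ (μ ▹ B) ∘ (σ ▹ B) ∘ α⇐ ∘ (A ◃ σ) ∘ (A ◃ σ)     ≈⟨ refl⟩∘⟨ refl⟩∘⟨ refl⟩∘⟨ refl⟩∘⟨ ◃-inverse σ-involutive ⟩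
        ε ∘ (μ ▹ B) ∘ (σ ▹ B) ∘ α⇐ ∘ id                    ≈⟨ refl⟩∘⟨ refl⟩∘⟨ refl⟩∘⟨ identityʳ ⟩
        ε ∘ (μ ▹ B) ∘ (σ ▹ B) ∘ α⇐                         ≈⟨ refl⟩∘⟨ pullˡ ▹-∘ ⟩
        ε ∘ ((μ ∘ σ) ▹ B) ∘ α⇐                             ∎)

      ▷-op : Op.▷ ≈ ◁ ∘ σ {B} {A}
      ▷-op = transposeʳ-unique (begin
        ε ∘ (A ◃ (◁ ∘ σ))                                  ≈⟨ refl⟩∘⟨ ◃-∘ ⟨
        ε ∘ (A ◃ ◁) ∘ (A ◃ σ)                              ≈⟨ pullˡ ◁-spec ⟩
        (ε ∘ (μ ▹ B) ∘ α⇐) ∘ (A ◃ σ)                       ≈⟨ assoc₃ ⟩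
        ε ∘ (μ ▹ B) ∘ α⇐ ∘ (A ◃ σ)                         ≈⟨ refl⟩∘⟨ refl⟩∘⟨ cancelˡ (▹-inverse σ-involutive) ⟨
        ε ∘ (μ ▹ B) ∘ (σ ▹ B) ∘ (σ ▹ B) ∘ α⇐ ∘ (A ◃ σ)     ≈⟨ refl⟩∘⟨ refl⟩∘⟨ refl⟩∘⟨ hexagon⁻¹ ⟨
        ε ∘ (μ ▹ B) ∘ (σ ▹ B) ∘ α⇐ ∘ σ ∘ α⇐                ≈⟨ refl⟩∘⟨ pullˡ ▹-∘ ⟩
        ε ∘ ((μ ∘ σ) ▹ B) ∘ α⇐ ∘ σ ∘ α⇐                    ∎)

  module FrobeniusProperties {O A B : Obj} {ε : (A ⊗₀ B) ⇒ O} {μ : (A ⊗₀ A) ⇒ A} {l r : A ⇒ B}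
                             (F : IsFrobenius O A B ε μ l r) where
    open IsFrobenius F
    open DualPairingProperties pairing

    l-isoˡ : l⁻¹ ∘ l ≈ id
    l-isoˡ = proj₁ (proj₂ l-iso)

    l-isoʳ : l ∘ l⁻¹ ≈ id
    l-isoʳ = proj₂ (proj₂ l-iso)

    r-isoˡ : r⁻¹ ∘ r ≈ id
    r-isoˡ = proj₁ (proj₂ r-iso)

    r-isoʳ : r ∘ r⁻¹ ≈ id
    r-isoʳ = proj₂ (proj₂ r-iso)

    ε-μ-cyclic : ε ∘ (μ ⊗₁ r) ≈ (ε ∘ (μ ⊗₁ l)) ∘ α⇐ ∘ σ {A ⊗₀ A} {A}
    ε-μ-cyclic = split-epi-cancel α-isoˡ (begin
      (ε ∘ (μ ⊗₁ r)) ∘ α⇐                 ≈⟨ ◁-◃ μ r ⟨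
      ε ∘ (A ◃ (◁ ∘ (A ◃ r)))             ≈⟨ refl⟩∘⟨ ⊗-resp-≈ ≈.refl ◁▷-lr ⟩
      ε ∘ (A ◃ (▷ ∘ (l ▹ A)))             ≈⟨ ▷-▹ μ l ⟩
      (ε ∘ (μ ⊗₁ l)) ∘ α⇐ ∘ σ ∘ α⇐        ≈⟨ refl⟩∘⟨ sym-assoc ⟩
      (ε ∘ (μ ⊗₁ l)) ∘ (α⇐ ∘ σ) ∘ α⇐      ≈⟨ sym-assoc ⟩
      ((ε ∘ (μ ⊗₁ l)) ∘ α⇐ ∘ σ) ∘ α⇐      ∎)

    ◁-◃l : ◁ ∘ (A ◃ l) ≈ l ∘ μ
    ◁-◃l = ◃-injective (begin
      ε ∘ (A ◃ (◁ ∘ (A ◃ l)))             ≈⟨ ◁-◃ μ l ⟩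
      (ε ∘ (μ ⊗₁ l)) ∘ α⇐                 ≈⟨ cancelʳ σ-involutive ⟨
      (((ε ∘ (μ ⊗₁ l)) ∘ α⇐) ∘ σ) ∘ σ     ≈⟨ ∘-assoc ⟩∘⟨refl ⟩
      ((ε ∘ (μ ⊗₁ l)) ∘ α⇐ ∘ σ) ∘ σ       ≈⟨ ε-μ-cyclic ⟩∘⟨refl ⟨
      (ε ∘ (μ ⊗₁ r)) ∘ σ                  ≈⟨ ∘-assoc ⟩
      ε ∘ (μ ⊗₁ r) ∘ σ                    ≈⟨ refl⟩∘⟨ ⊗-∘σ ⟩
      ε ∘ (A ◃ r) ∘ σ ∘ (A ◃ μ)           ≈⟨ pullˡ ε-lr ⟩
      ((ε ∘ (A ◃ l)) ∘ σ) ∘ σ ∘ (A ◃ μ)   ≈⟨ ∘-assoc ⟩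
      (ε ∘ (A ◃ l)) ∘ σ ∘ σ ∘ (A ◃ μ)     ≈⟨ refl⟩∘⟨ cancelˡ σ-involutive ⟩
      (ε ∘ (A ◃ l)) ∘ (A ◃ μ)             ≈⟨ ∘-assoc ⟩
      ε ∘ (A ◃ l) ∘ (A ◃ μ)               ≈⟨ refl⟩∘⟨ ◃-∘ ⟩
      ε ∘ (A ◃ (l ∘ μ))                   ∎)

    ▷-r▹ : ▷ ∘ (r ▹ A) ≈ r ∘ μ
    ▷-r▹ = ◃-injective (begin
      ε ∘ (A ◃ (▷ ∘ (r ▹ A)))                      ≈⟨ ▷-▹ μ r ⟩
      (ε ∘ (μ ⊗₁ r)) ∘ α⇐ ∘ σ ∘ α⇐                 ≈⟨ ε-μ-cyclic ⟩∘⟨refl ⟩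
      ((ε ∘ (μ ⊗₁ l)) ∘ α⇐ ∘ σ) ∘ α⇐ ∘ σ ∘ α⇐      ≈⟨ assoc₃ ⟩
      (ε ∘ (μ ⊗₁ l)) ∘ α⇐ ∘ σ ∘ α⇐ ∘ σ ∘ α⇐        ≈⟨ refl⟩∘⟨ σ-rotate² ⟩
      (ε ∘ (μ ⊗₁ l)) ∘ σ                           ≈⟨ ∘-assoc ⟩
      ε ∘ (μ ⊗₁ l) ∘ σ                             ≈⟨ refl⟩∘⟨ ⊗-∘σ ⟩
      ε ∘ (A ◃ l) ∘ σ ∘ (A ◃ μ)                    ≈⟨ pull₃ (≈.trans sym-assoc (≈.sym ε-lr)) ⟩
      (ε ∘ (A ◃ r)) ∘ (A ◃ μ)                      ≈⟨ ∘-assoc ⟩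
      ε ∘ (A ◃ r) ∘ (A ◃ μ)                        ≈⟨ refl⟩∘⟨ ◃-∘ ⟩
      ε ∘ (A ◃ (r ∘ μ))                            ∎)

    μB-◃r : μB ∘ (B ◃ r) ≈ ▷
    μB-◃r = cancelʳ (◃-inverse r-isoˡ)

    μB-l▹ : μB ∘ (l ▹ B) ≈ ◁
    μB-l▹ = split-epi-cancel (◃-inverse r-isoʳ) (begin
      (μB ∘ (l ▹ B)) ∘ (A ◃ r)   ≈⟨ ∘-assoc ⟩
      μB ∘ (l ▹ B) ∘ (A ◃ r)     ≈⟨ refl⟩∘⟨ ▹◃-comm ⟩
      μB ∘ (B ◃ r) ∘ (l ▹ A)     ≈⟨ pullˡ μB-◃r ⟩
      ▷ ∘ (l ▹ A)                ≈⟨ ◁▷-lr ⟨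
      ◁ ∘ (A ◃ r)                ∎)

    l-homomorphism : l ∘ μ ≈ μB ∘ (l ⊗₁ l)
    l-homomorphism = begin
      l ∘ μ                    ≈⟨ ◁-◃l ⟨
      ◁ ∘ (A ◃ l)              ≈⟨ pullˡ μB-l▹ ⟨
      μB ∘ (l ▹ B) ∘ (A ◃ l)   ≈⟨ refl⟩∘⟨ ⊗-as-▹◃ ⟨
      μB ∘ (l ⊗₁ l)            ∎

    r-homomorphism : r ∘ μ ≈ μB ∘ (r ⊗₁ r)
    r-homomorphism = begin
      r ∘ μ                    ≈⟨ ▷-r▹ ⟨
      ▷ ∘ (r ▹ A)              ≈⟨ pullˡ μB-◃r ⟨
      μB ∘ (B ◃ r) ∘ (r ▹ A)   ≈⟨ refl⟩∘⟨ ⊗-as-◃▹ ⟨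
      μB ∘ (r ⊗₁ r)            ∎

    μB-assoc : Associative μB
    μB-assoc = Associative-transport l-iso l-homomorphism assoc

    opposite : IsFrobenius O A B ε (μ ∘ σ {A} {A}) r l
    opposite = record
      { pairing = pairing
      ; assoc   = Associative-op assoc
      ; l-iso   = r-iso
      ; r-iso   = l-iso
      ; ε-lr    = ≈.sym (≈.trans (ε-lr ⟩∘⟨refl) (cancelʳ σ-involutive))
      ; ◁▷-lr   = begin
          Op.◁ ∘ (A ◃ l)        ≈⟨ ◁-op μ ⟩∘⟨refl ⟩
          (▷ ∘ σ) ∘ (A ◃ l)     ≈⟨ extendˡ σ-natural ⟩
          (▷ ∘ (l ▹ A)) ∘ σ     ≈⟨ ◁▷-lr ⟩∘⟨refl ⟨
          (◁ ∘ (A ◃ r)) ∘ σ     ≈⟨ extendˡ σ-natural ⟨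
          (◁ ∘ σ) ∘ (r ▹ A)     ≈⟨ ▷-op μ ⟩∘⟨refl ⟨
          Op.▷ ∘ (r ▹ A)        ∎
      }
      where module Op = Actions pairing (μ ∘ σ {A} {A})

    module Dual = Actions swapped μB
    private module Swapped = DualPairingProperties swapped

    swapped-◃μ : ∀ {X} {h : X ⇒ (A ⊗₀ A)} {k : (A ⊗₀ A) ⇒ X} → h ∘ k ≈ id →
                 ((ε ∘ σ) ∘ (B ◃ (μ ∘ h))) ∘ (B ◃ k) ≈ ε ∘ (μ ▹ B) ∘ σ
    swapped-◃μ {h = h} {k} hk = begin
      ((ε ∘ σ) ∘ (B ◃ (μ ∘ h))) ∘ (B ◃ k)  ≈⟨ ∘-assoc ⟩
      (ε ∘ σ) ∘ (B ◃ (μ ∘ h)) ∘ (B ◃ k)    ≈⟨ refl⟩∘⟨ ◃-∘ ⟩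
      (ε ∘ σ) ∘ (B ◃ ((μ ∘ h) ∘ k))        ≈⟨ refl⟩∘⟨ ⊗-resp-≈ ≈.refl (cancelʳ hk) ⟩
      (ε ∘ σ) ∘ (B ◃ μ)                    ≈⟨ ∘-assoc ⟩
      ε ∘ σ ∘ (B ◃ μ)                      ≈⟨ refl⟩∘⟨ σ-natural ⟩
      ε ∘ (μ ▹ B) ∘ σ                      ∎

    swapped-▷ : (ε ∘ σ) ∘ (▷ ▹ A) ∘ α⇐ ≈ ε ∘ (μ ▹ B) ∘ σ
    swapped-▷ = begin
      (ε ∘ σ) ∘ (▷ ▹ A) ∘ α⇐                  ≈⟨ ∘-assoc ⟩
      ε ∘ σ ∘ (▷ ▹ A) ∘ α⇐                    ≈⟨ refl⟩∘⟨ extendʳ σ-natural ⟩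
      ε ∘ (A ◃ ▷) ∘ σ ∘ α⇐                    ≈⟨ pullˡ (▷-spec μ) ⟩
      (ε ∘ (μ ▹ B) ∘ α⇐ ∘ σ ∘ α⇐) ∘ σ ∘ α⇐    ≈⟨ assoc₅ ⟩
      ε ∘ (μ ▹ B) ∘ α⇐ ∘ σ ∘ α⇐ ∘ σ ∘ α⇐      ≈⟨ refl⟩∘⟨ refl⟩∘⟨ σ-rotate² ⟩
      ε ∘ (μ ▹ B) ∘ σ                         ∎

    swapped-◁ : (ε ∘ σ) ∘ (◁ ▹ A) ∘ α⇐ ∘ σ ∘ α⇐ ≈ ε ∘ (μ ▹ B) ∘ σ
    swapped-◁ = begin
      (ε ∘ σ) ∘ (◁ ▹ A) ∘ α⇐ ∘ σ ∘ α⇐         ≈⟨ ∘-assoc ⟩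
      ε ∘ σ ∘ (◁ ▹ A) ∘ α⇐ ∘ σ ∘ α⇐           ≈⟨ refl⟩∘⟨ extendʳ σ-natural ⟩
      ε ∘ (A ◃ ◁) ∘ σ ∘ α⇐ ∘ σ ∘ α⇐           ≈⟨ pullˡ (◁-spec μ) ⟩
      (ε ∘ (μ ▹ B) ∘ α⇐) ∘ σ ∘ α⇐ ∘ σ ∘ α⇐    ≈⟨ assoc₃ ⟩
      ε ∘ (μ ▹ B) ∘ α⇐ ∘ σ ∘ α⇐ ∘ σ ∘ α⇐      ≈⟨ refl⟩∘⟨ refl⟩∘⟨ σ-rotate² ⟩
      ε ∘ (μ ▹ B) ∘ σ                         ∎

    ◁-dual : Dual.◁ ≈ μ ∘ (r⁻¹ ▹ A)
    ◁-dual = Swapped.transposeʳ-unique (split-epi-cancel (◃-inverse (▹-inverse r-isoʳ)) (begin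
      ((ε ∘ σ) ∘ (B ◃ (μ ∘ (r⁻¹ ▹ A)))) ∘ (B ◃ (r ▹ A))  ≈⟨ swapped-◃μ (▹-inverse r-isoˡ) ⟩
      ε ∘ (μ ▹ B) ∘ σ                                    ≈⟨ swapped-▷ ⟨
      (ε ∘ σ) ∘ (▷ ▹ A) ∘ α⇐                             ≈⟨ refl⟩∘⟨ ⊗-resp-≈ μB-◃r ≈.refl ⟩∘⟨refl ⟨
      (ε ∘ σ) ∘ ((μB ∘ (B ◃ r)) ▹ A) ∘ α⇐                ≈⟨ refl⟩∘⟨ pullˡ ▹-∘ ⟨
      (ε ∘ σ) ∘ (μB ▹ A) ∘ ((B ◃ r) ▹ A) ∘ α⇐            ≈⟨ refl⟩∘⟨ refl⟩∘⟨ α⇐-natural ⟨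
      (ε ∘ σ) ∘ (μB ▹ A) ∘ α⇐ ∘ (B ◃ (r ▹ A))            ≈⟨ assoc₃ ⟨
      ((ε ∘ σ) ∘ (μB ▹ A) ∘ α⇐) ∘ (B ◃ (r ▹ A))          ∎))

    ▷-dual : Dual.▷ ≈ μ ∘ (A ◃ l⁻¹)
    ▷-dual = Swapped.transposeʳ-unique (split-epi-cancel (◃-inverse (◃-inverse l-isoʳ)) (begin
      ((ε ∘ σ) ∘ (B ◃ (μ ∘ (A ◃ l⁻¹)))) ∘ (B ◃ (A ◃ l))   ≈⟨ swapped-◃μ (◃-inverse l-isoˡ) ⟩
      ε ∘ (μ ▹ B) ∘ σ                                     ≈⟨ swapped-◁ ⟨
      (ε ∘ σ) ∘ (◁ ▹ A) ∘ α⇐ ∘ σ ∘ α⇐                     ≈⟨ refl⟩∘⟨ ⊗-resp-≈ μB-l▹ ≈.refl ⟩∘⟨refl ⟨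
      (ε ∘ σ) ∘ ((μB ∘ (l ▹ B)) ▹ A) ∘ α⇐ ∘ σ ∘ α⇐        ≈⟨ refl⟩∘⟨ pullˡ ▹-∘ ⟨
      (ε ∘ σ) ∘ (μB ▹ A) ∘ ((l ▹ B) ▹ A) ∘ α⇐ ∘ σ ∘ α⇐    ≈⟨ refl⟩∘⟨ refl⟩∘⟨ extendʳ α⇐-▹ ⟨
      (ε ∘ σ) ∘ (μB ▹ A) ∘ α⇐ ∘ (l ▹ (B ⊗₀ A)) ∘ σ ∘ α⇐   ≈⟨ refl⟩∘⟨ refl⟩∘⟨ refl⟩∘⟨ extendʳ σ-natural ⟨
      (ε ∘ σ) ∘ (μB ▹ A) ∘ α⇐ ∘ σ ∘ ((B ⊗₀ A) ◃ l) ∘ α⇐   ≈⟨ refl⟩∘⟨ refl⟩∘⟨ refl⟩∘⟨ refl⟩∘⟨ α⇐-◃◃ ⟨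
      (ε ∘ σ) ∘ (μB ▹ A) ∘ α⇐ ∘ σ ∘ α⇐ ∘ (B ◃ (A ◃ l))    ≈⟨ assoc₅ ⟨
      ((ε ∘ σ) ∘ (μB ▹ A) ∘ α⇐ ∘ σ ∘ α⇐) ∘ (B ◃ (A ◃ l))  ∎))

    ε-l⁻¹r⁻¹ : ε ∘ (l⁻¹ ▹ B) ≈ (ε ∘ (r⁻¹ ▹ B)) ∘ σ {B} {B}
    ε-l⁻¹r⁻¹ = begin
      ε ∘ (l⁻¹ ▹ B)                          ≈⟨ refl⟩∘⟨ ⊗-resp-≈ identityˡ r-isoʳ ⟨
      ε ∘ ((id ∘ l⁻¹) ⊗₁ (r ∘ r⁻¹))          ≈⟨ refl⟩∘⟨ ⊗-∘ ⟩
      ε ∘ (A ◃ r) ∘ (l⁻¹ ⊗₁ r⁻¹)             ≈⟨ pullˡ ε-lr ⟩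
      ((ε ∘ (A ◃ l)) ∘ σ) ∘ (l⁻¹ ⊗₁ r⁻¹)     ≈⟨ extendˡ σ-natural ⟩
      ((ε ∘ (A ◃ l)) ∘ (r⁻¹ ⊗₁ l⁻¹)) ∘ σ     ≈⟨ ∘-assoc ⟩∘⟨refl ⟩
      (ε ∘ (A ◃ l) ∘ (r⁻¹ ⊗₁ l⁻¹)) ∘ σ       ≈⟨ (refl⟩∘⟨ ≈.sym ⊗-∘) ⟩∘⟨refl ⟩
      (ε ∘ ((id ∘ r⁻¹) ⊗₁ (l ∘ l⁻¹))) ∘ σ    ≈⟨ (refl⟩∘⟨ ⊗-resp-≈ identityˡ l-isoʳ) ⟩∘⟨refl ⟩
      (ε ∘ (r⁻¹ ▹ B)) ∘ σ                    ∎

    dual : IsFrobenius O B A (ε ∘ σ {B} {A}) μB r⁻¹ l⁻¹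
    dual = record
      { pairing = swapped
      ; assoc   = μB-assoc
      ; l-iso   = r , r-isoʳ , r-isoˡ
      ; r-iso   = l , l-isoʳ , l-isoˡ
      ; ε-lr    = begin
          (ε ∘ σ) ∘ (B ◃ l⁻¹)          ≈⟨ extendˡ σ-natural ⟩
          (ε ∘ (l⁻¹ ▹ B)) ∘ σ          ≈⟨ ε-l⁻¹r⁻¹ ⟩∘⟨refl ⟩
          ((ε ∘ (r⁻¹ ▹ B)) ∘ σ) ∘ σ    ≈⟨ extendˡ σ-natural ⟩∘⟨refl ⟨
          ((ε ∘ σ) ∘ (B ◃ r⁻¹)) ∘ σ    ∎
      ; ◁▷-lr   = begin
          Dual.◁ ∘ (B ◃ l⁻¹)             ≈⟨ ◁-dual ⟩∘⟨refl ⟩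
          (μ ∘ (r⁻¹ ▹ A)) ∘ (B ◃ l⁻¹)    ≈⟨ extendˡ ▹◃-comm ⟩
          (μ ∘ (A ◃ l⁻¹)) ∘ (r⁻¹ ▹ B)    ≈⟨ ▷-dual ⟩∘⟨refl ⟨
          Dual.▷ ∘ (r⁻¹ ▹ B)             ∎
      }

mainTheorem16 : ∀ {o ℓ e} (𝒱 : SymmetricMonoidalCategory o ℓ e) →
    let open Frobenius 𝒱 in
    (O A B : Obj) (ε : (A ⊗₀ B) ⇒ O) (μA : (A ⊗₀ A) ⇒ A) (l r : A ⇒ B) →
    (F : IsFrobenius O A B ε μA l r) →
    let open IsFrobenius F in
    -- (1)
    IsFrobenius O A B ε (μA ∘ σ {A} {A}) r l
    -- (2)
    × Associative μB
    -- (3)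
    × ((◁ ∘ (A ◃ l) ≈ l ∘ μA) × (▷ ∘ (r ▹ A) ≈ r ∘ μA))
    -- (4)
    × ((l ∘ μA ≈ μB ∘ (l ⊗₁ l)) × (r ∘ μA ≈ μB ∘ (r ⊗₁ r)))
    -- (5)
    × IsFrobenius O B A (ε ∘ σ {B} {A}) μB r⁻¹ l⁻¹
mainTheorem16 𝒱 O A B ε μA l r F =
  opposite , μB-assoc , (◁-◃l , ▷-r▹) , (l-homomorphism , r-homomorphism) , dual
  where open FrobeniusProperties 𝒱 F
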